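{- Let $T$ be a tree containing at least one strong support vertex, let $v_1,\dots,v_t$ be the strong support vertices of $T$, and for each $i$ let $l_i$ be the number of leaves adjacent to $v_i$. If $T$ has a $pc$-partition, then $PC(T)\ge \max\{l_i: 1\le i\le t\}+1$.
   Context: A leaf is a vertex of degree 1; its neighbor is a support vertex; a strong support vertex is a vertex adjacent to at least two leaves. A paired dominating set of $G$ is a dominating set $S$ such that $G[S]$ has a perfect matching. Two disjoint sets form a paired coalition if neither is a paired dominating set but their union is. A $pc$-partition of $G$ is a partition of $V(G)$ into nonempty sets, none a paired dominating set, each forming a paired coalition with some other set of the partition. $PC(G)$ is the maximum number of sets in a $pc$-partition of $G$. -}

module Defs where

open import Data.Nat using (ℕ; zero; suc; _≤_; _⊔_; _≡ᵇ_; _≤ᵇ_)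
open import Data.Bool using (Bool; true; false; _∧_; if_then_else_)
open import Data.Fin using (Fin)
open import Data.Fin.Subset using (Subset; _∈_; _∉_; _∪_)
open import Data.List using (List; []; _∷_; _++_; [_]; length; foldr; map)
open import Data.List.Relation.Unary.Linked using (Linked)
open import Data.List.Relation.Unary.Unique.Propositional using (Unique)
open import Data.Product using (Σ; ∃; _×_; _,_)
open import Data.Sum using (_⊎_)
open import Relation.Binary.PropositionalEquality using (_≡_; _≢_)
open import Relation.Nullary using (¬_)

record Graph (n : ℕ) : Set where
  field
    adj   : Fin n → Fin n → Bool
    sym   : ∀ u v → adj u v ≡ adj v u
    irrefl : ∀ v → adj v v ≡ false

open Graph public

Adj : ∀ {n} → Graph n → Fin n → Fin n → Set
Adj G u v = adj G u v ≡ true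

data Walk {n : ℕ} (G : Graph n) : Fin n → Fin n → Set where
  here : ∀ {v} → Walk G v v
  step : ∀ {u w v} → Adj G u w → Walk G w v → Walk G u v

Connected : ∀ {n} → Graph n → Set
Connected G = ∀ u v → Walk G u v

IsCycle : ∀ {n} → Graph n → Fin n → List (Fin n) → Set
IsCycle G x xs = (2 ≤ length xs) × Unique (x ∷ xs) × Linked (Adj G) (x ∷ xs ++ [ x ])

Acyclic : ∀ {n} → Graph n → Set
Acyclic G = ∀ x xs → ¬ IsCycle G x xs

IsTree : ∀ {n} → Graph n → Set
IsTree G = Connected G × Acyclic G

allV : ∀ n → List (Fin n)
allV n = Data.List.allFin n
  where import Data.List

countB : ∀ {A : Set} → (A → Bool) → List A → ℕ
countB p [] = 0
countB p (x ∷ xs) = if p x then suc (countB p xs) else countB p xs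

filterB : ∀ {A : Set} → (A → Bool) → List A → List A
filterB p [] = []
filterB p (x ∷ xs) = if p x then x ∷ filterB p xs else filterB p xs

degree : ∀ {n} → Graph n → Fin n → ℕ
degree {n} G v = countB (adj G v) (allV n)

isLeaf : ∀ {n} → Graph n → Fin n → Bool
isLeaf G v = degree G v ≡ᵇ 1

leafCount : ∀ {n} → Graph n → Fin n → ℕ
leafCount {n} G v = countB (λ u → adj G v u ∧ isLeaf G u) (allV n)

isStrongSupport : ∀ {n} → Graph n → Fin n → Bool
isStrongSupport G v = 2 ≤ᵇ leafCount G v

StrongSupport : ∀ {n} → Graph n → Fin n → Set
StrongSupport G v = isStrongSupport G v ≡ true

-- max { l_i : v_i a strong support vertex } (0 if there are none)
maxStrongLeaves : ∀ {n} → Graph n → ℕ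
maxStrongLeaves {n} G = foldr _⊔_ 0 (map (leafCount G) (filterB (isStrongSupport G) (allV n)))

Dominating : ∀ {n} → Graph n → Subset n → Set
Dominating G S = ∀ v → v ∈ S ⊎ ∃ λ u → u ∈ S × Adj G u v

HasPerfectMatching : ∀ {n} → Graph n → Subset n → Set
HasPerfectMatching {n} G S =
  Σ (Fin n → Fin n) λ m → ∀ v → v ∈ S → (m v ∈ S) × Adj G v (m v) × (m (m v) ≡ v)

PairedDominating : ∀ {n} → Graph n → Subset n → Set
PairedDominating G S = Dominating G S × HasPerfectMatching G S

classOf : ∀ {n k} → (Fin n → Fin k) → Fin k → Subset n
classOf {n} p i = Data.Vec.tabulate (λ v → Relation.Nullary.Decidable.Core.isYes (p v Data.Fin.≟ i))
  where import Data.Vec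
        import Relation.Nullary.Decidable.Core
        import Data.Fin

IsPCPartition : ∀ {n} → Graph n → (k : ℕ) → (Fin n → Fin k) → Set
IsPCPartition {n} G k p =
    (∀ i → ∃ λ v → p v ≡ i)
  × (∀ i → ¬ PairedDominating G (classOf p i))
  × (∀ i → ∃ λ j → (j ≢ i) × PairedDominating G (classOf p i ∪ classOf p j))

HasPCPartitionOfOrder : ∀ {n} → Graph n → ℕ → Set
HasPCPartitionOfOrder {n} G k = Σ (Fin n → Fin k) (IsPCPartition G k)

HasPCPartition : ∀ {n} → Graph n → Set
HasPCPartition G = ∃ λ k → HasPCPartitionOfOrder G k

-- PC(G) ≥ m  (PC(G) is the maximum order of a pc-partition)
PCAtLeast : ∀ {n} → Graph n → ℕ → Set
PCAtLeast G m = ∃ λ k → (m ≤ k) × HasPCPartitionOfOrder G k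

{-# OPTIONS --safe #-}
-- Let v be a strong support vertex with leaves x₁, …, x_l.  Every paired
-- dominating set D contains v (a leaf in D is matched to v, a leaf outside D
-- is dominated by v) and at most one xᵢ (each xᵢ in D is matched to v).
-- Each class of a pc-partition lies in such a D, the union of two classes,
-- so the xᵢ lie in pairwise distinct classes.  Nor does the class of v
-- contain a leaf x: for another leaf y, the set D containing the class of y
-- contains v, hence the class of v, hence both x and y.  Thus v, x₁, …, x_l
-- meet l + 1 distinct classes.
module Submission where

open import Defs
open import Data.Nat using (ℕ; suc)
open import Data.Fin using (Fin)
open import Data.Product using (∃)

open import Data.Bool using (Bool; true; false; T; _∧_)
open import Data.Bool.Properties using (T-≡; T-∧)
open import Data.Fin using (zero; suc; _≟_)
open import Data.Fin.Properties using (injective⇒≤; nonZeroIndex)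
open import Data.Fin.Subset using (_∪_) renaming (_∈_ to _∈ˢ_)
open import Data.Fin.Subset.Properties using (x∈p∪q⁺; x∈p∪q⁻)
open import Data.List using (List; []; _∷_; length; lookup; filterᵇ)
open import Data.List.Membership.Propositional using (_∈_)
open import Data.List.Membership.Propositional.Properties
  using (∈-filter⁺; ∈-filter⁻; ∈-allFin; ∈-lookup)
open import Data.List.Properties using (foldr-preservesᵇ)
open import Data.List.Relation.Unary.All as All using (_∷_)
import Data.List.Relation.Unary.All.Properties as All
open import Data.List.Relation.Unary.AllPairs using (_∷_)
open import Data.List.Relation.Unary.Any using (here; there)
open import Data.List.Relation.Unary.Unique.Propositional using (Unique)
open import Data.List.Relation.Unary.Unique.Propositional.Properties
  using (allFin⁺) renaming (filter⁺ to unique-filter⁺)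
open import Data.Nat using (_≤_; _<_; s≤s; >-nonZero⁻¹)
open import Data.Nat.Properties using (≡ᵇ⇒≡; ≤ᵇ⇒≤; ⊔-pres-<m)
open import Data.Product using (_×_; _,_; proj₁; proj₂; ∃₂)
open import Data.Sum using (inj₁; inj₂)
import Data.Sum as Sum
open import Data.Vec.Properties using (lookup∘tabulate; []=⇒lookup; lookup⇒[]=)
open import Function using (_∘_; Equivalence)
open import Relation.Nullary using (contradiction)
open import Relation.Nullary.Decidable using (toWitness; fromWitness; T?)
open import Relation.Binary.PropositionalEquality
  using (_≡_; _≢_; refl; cong; subst; trans; module ≡-Reasoning) renaming (sym to ≡-sym)

private
  variable
    A : Set
    n k : ℕ

T⇒≡true : ∀ {b} → T b → b ≡ true
T⇒≡true = Equivalence.to T-≡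

≡true⇒T : ∀ {b} → b ≡ true → T b
≡true⇒T = Equivalence.from T-≡

filterB≡filterᵇ : (P : A → Bool) (xs : List A) → filterB P xs ≡ filterᵇ P xs
filterB≡filterᵇ P [] = refl
filterB≡filterᵇ P (x ∷ xs) with P x
... | true  = cong (x ∷_) (filterB≡filterᵇ P xs)
... | false = filterB≡filterᵇ P xs

countB≡length∘filterᵇ : (P : A → Bool) (xs : List A) → countB P xs ≡ length (filterᵇ P xs)
countB≡length∘filterᵇ P [] = refl
countB≡length∘filterᵇ P (x ∷ xs) with P x
... | true  = cong suc (countB≡length∘filterᵇ P xs)
... | false = countB≡length∘filterᵇ P xs

lookup-injective : {xs : List A} → Unique xs → ∀ i j → lookup xs i ≡ lookup xs j → i ≡ j
lookup-injective (_ ∷ _)      zero    zero    _  = refl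
lookup-injective (x∉xs ∷ _)   zero    (suc j) eq = contradiction eq (All.lookup x∉xs (∈-lookup j))
lookup-injective (x∉xs ∷ _)   (suc i) zero    eq = contradiction (≡-sym eq) (All.lookup x∉xs (∈-lookup i))
lookup-injective (_ ∷ unique) (suc i) (suc j) eq = cong suc (lookup-injective unique i j eq)

injectiveOn⇒length≤ : (f : A → Fin k) {xs : List A} → Unique xs →
  (∀ {x y} → x ∈ xs → y ∈ xs → f x ≡ f y → x ≡ y) → length xs ≤ k
injectiveOn⇒length≤ f unique injectiveOn =
  injective⇒≤ λ {i} {j} eq → lookup-injective unique i j (injectiveOn (∈-lookup i) (∈-lookup j) eq)

distinct-pair : {xs : List A} → Unique xs → 2 ≤ length xs → ∃₂ λ x y → x ∈ xs × y ∈ xs × x ≢ y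
distinct-pair {xs = x ∷ y ∷ _} ((x≢y ∷ _) ∷ _) _         = x , y , here refl , there (here refl) , x≢y
distinct-pair {xs = _ ∷ []}    _                  (s≤s ())

∈-classOf⁺ : (p : Fin n → Fin k) {i : Fin k} {u : Fin n} → p u ≡ i → u ∈ˢ classOf p i
∈-classOf⁺ p {i} {u} pu≡i =
  lookup⇒[]= u _ (trans (lookup∘tabulate _ u) (T⇒≡true (fromWitness {a? = p u ≟ i} pu≡i)))

∈-classOf⁻ : (p : Fin n → Fin k) {i : Fin k} {u : Fin n} → u ∈ˢ classOf p i → p u ≡ i
∈-classOf⁻ p {i} {u} u∈ =
  toWitness {a? = p u ≟ i} (≡true⇒T (trans (≡-sym (lookup∘tabulate _ u)) ([]=⇒lookup u∈)))

∈-classOf-resp : (p : Fin n → Fin k) {i : Fin k} {u w : Fin n} →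
  p u ≡ p w → u ∈ˢ classOf p i → w ∈ˢ classOf p i
∈-classOf-resp p pu≡pw u∈ = ∈-classOf⁺ p (trans (≡-sym pu≡pw) (∈-classOf⁻ p u∈))

module _ (G : Graph n) where

  Leaf : Fin n → Set
  Leaf x = isLeaf G x ≡ true

  LeafOf : Fin n → Fin n → Set
  LeafOf v x = Adj G v x × Leaf x

  adj-sym : ∀ {u v} → Adj G u v → Adj G v u
  adj-sym {u} {v} = trans (Graph.sym G v u)

  adj⇒≢ : ∀ {u v} → Adj G u v → u ≢ v
  adj⇒≢ {u} uv refl with trans (≡-sym uv) (irrefl G u)
  ... | ()

  neighbours : Fin n → List (Fin n)
  neighbours x = filterᵇ (adj G x) (allV n)

  isLeafOf : Fin n → Fin n → Bool
  isLeafOf v u = adj G v u ∧ isLeaf G u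

  leavesOf : Fin n → List (Fin n)
  leavesOf v = filterᵇ (isLeafOf v) (allV n)

  leaf-neighbour-unique : ∀ {x u w} → Leaf x → Adj G x u → Adj G x w → u ≡ w
  leaf-neighbour-unique {x} leaf xu xw =
    singleton-∈ length-neighbours≡1 (neighbour xu) (neighbour xw)
    where
    length-neighbours≡1 : length (neighbours x) ≡ 1
    length-neighbours≡1 =
      trans (≡-sym (countB≡length∘filterᵇ (adj G x) (allV n))) (≡ᵇ⇒≡ _ 1 (≡true⇒T leaf))
    neighbour : ∀ {y} → Adj G x y → y ∈ neighbours x
    neighbour xy = ∈-filter⁺ (T? ∘ adj G x) (∈-allFin _) (≡true⇒T xy)
    singleton-∈ : ∀ {ys : List (Fin n)} {a b} → length ys ≡ 1 → a ∈ ys → b ∈ ys → a ≡ b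
    singleton-∈ {_ ∷ []} _ (here refl) (here refl) = refl

  ∈-leavesOf⁻ : ∀ {v x} → x ∈ leavesOf v → LeafOf v x
  ∈-leavesOf⁻ {v} x∈ with Equivalence.to T-∧ (proj₂ (∈-filter⁻ (T? ∘ isLeafOf v) {xs = allV n} x∈))
  ... | vx , leaf = T⇒≡true vx , T⇒≡true leaf

  length-leavesOf : ∀ v → length (leavesOf v) ≡ leafCount G v
  length-leavesOf v = ≡-sym (countB≡length∘filterᵇ _ (allV n))

  unique-leavesOf : ∀ v → Unique (leavesOf v)
  unique-leavesOf v = unique-filter⁺ (T? ∘ isLeafOf v) (allFin⁺ n)

  two≤leafCount : ∀ {v} → StrongSupport G v → 2 ≤ length (leavesOf v)
  two≤leafCount {v} strong = subst (2 ≤_) (≡-sym (length-leavesOf v)) (≤ᵇ⇒≤ 2 _ (≡true⇒T strong))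

  ∈-strongSupports⁻ : ∀ {v} → v ∈ filterB (isStrongSupport G) (allV n) → StrongSupport G v
  ∈-strongSupports⁻ {v} v∈ =
    T⇒≡true (proj₂ (∈-filter⁻ (T? ∘ isStrongSupport G) {xs = allV n}
      (subst (v ∈_) (filterB≡filterᵇ (isStrongSupport G) (allV n)) v∈)))

  support∈pairedDominating : ∀ {S v x} → PairedDominating G S → LeafOf v x → v ∈ˢ S
  support∈pairedDominating {S} {x = x} (dominating , _ , matched) (vx , leaf) with dominating x
  ... | inj₁ x∈S =
    let (mx∈S , x~mx , _) = matched x x∈S
    in subst (_∈ˢ S) (leaf-neighbour-unique leaf x~mx (adj-sym vx)) mx∈S
  ... | inj₂ (u , u∈S , ux) = subst (_∈ˢ S) (leaf-neighbour-unique leaf (adj-sym ux) (adj-sym vx)) u∈S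

  matched-sibling-leaves : ∀ {S v x y} → HasPerfectMatching G S → LeafOf v x → LeafOf v y →
    x ∈ˢ S → y ∈ˢ S → x ≡ y
  matched-sibling-leaves {S} {v} {x} {y} (m , matched) leafOfˣ leafOfʸ x∈S y∈S = begin
    x       ≡⟨ ≡-sym (involutive x∈S) ⟩
    m (m x) ≡⟨ cong m (trans (partner≡support x∈S leafOfˣ) (≡-sym (partner≡support y∈S leafOfʸ))) ⟩
    m (m y) ≡⟨ involutive y∈S ⟩
    y       ∎
    where
    open ≡-Reasoning
    involutive : ∀ {z} → z ∈ˢ S → m (m z) ≡ z
    involutive z∈S = proj₂ (proj₂ (matched _ z∈S))
    partner≡support : ∀ {z} → z ∈ˢ S → LeafOf v z → m z ≡ v
    partner≡support z∈S (vz , leaf) = leaf-neighbour-unique leaf (proj₁ (proj₂ (matched _ z∈S))) (adj-sym vz)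

  module _ {k} (p : Fin n → Fin k)
           (coalition : ∀ i → ∃ λ j → PairedDominating G (classOf p i ∪ classOf p j)) where

    sibling-leaves-separated : ∀ {v x y} → LeafOf v x → LeafOf v y → p x ≡ p y → x ≡ y
    sibling-leaves-separated leafOfˣ leafOfʸ px≡py with coalition (p _)
    ... | _ , _ , matching =
      matched-sibling-leaves matching leafOfˣ leafOfʸ
        (x∈p∪q⁺ (inj₁ (∈-classOf⁺ p refl))) (x∈p∪q⁺ (inj₁ (∈-classOf⁺ p (≡-sym px≡py))))

    leaf-in-support-class-unique : ∀ {v x y} → LeafOf v x → LeafOf v y → p v ≡ p x → x ≡ y
    leaf-in-support-class-unique {v} {x} {y} leafOfˣ leafOfʸ pv≡px with coalition (p y)
    ... | j , dominating@(_ , matching) =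
      matched-sibling-leaves matching leafOfˣ leafOfʸ x∈D (x∈p∪q⁺ (inj₁ (∈-classOf⁺ p refl)))
      where
      x∈D : x ∈ˢ (classOf p (p y) ∪ classOf p j)
      x∈D = x∈p∪q⁺ (Sum.map (∈-classOf-resp p pv≡px) (∈-classOf-resp p pv≡px)
                     (x∈p∪q⁻ _ _ (support∈pairedDominating dominating leafOfʸ)))

    strong-support-class-leafless : ∀ {v x} → StrongSupport G v → LeafOf v x → p v ≢ p x
    strong-support-class-leafless {v} strong leafOfˣ pv≡px
      with distinct-pair (unique-leavesOf v) (two≤leafCount strong)
    ... | a , b , a∈ , b∈ , a≢b =
      a≢b (trans (≡-sym (leaf-in-support-class-unique leafOfˣ (∈-leavesOf⁻ a∈) pv≡px))
                 (leaf-in-support-class-unique leafOfˣ (∈-leavesOf⁻ b∈) pv≡px))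

    leafCount<order : ∀ {v} → StrongSupport G v → leafCount G v < k
    leafCount<order {v} strong =
      subst (_< k) (length-leavesOf v) (injectiveOn⇒length≤ p unique injectiveOn)
      where
      unique : Unique (v ∷ leavesOf v)
      unique = All.tabulate (λ x∈ → adj⇒≢ (proj₁ (∈-leavesOf⁻ x∈))) ∷ unique-leavesOf v
      injectiveOn : ∀ {x y} → x ∈ v ∷ leavesOf v → y ∈ v ∷ leavesOf v → p x ≡ p y → x ≡ y
      injectiveOn (here refl) (here refl) _  = refl
      injectiveOn (here refl) (there y∈)  eq =
        contradiction eq (strong-support-class-leafless strong (∈-leavesOf⁻ y∈))
      injectiveOn (there x∈)  (here refl) eq =
        contradiction (≡-sym eq) (strong-support-class-leafless strong (∈-leavesOf⁻ x∈))
      injectiveOn (there x∈)  (there y∈)  eq =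
        sibling-leaves-separated (∈-leavesOf⁻ x∈) (∈-leavesOf⁻ y∈) eq

    maxStrongLeaves<order : Fin n → maxStrongLeaves G < k
    maxStrongLeaves<order v =
      foldr-preservesᵇ {P = _< k} ⊔-pres-<m (>-nonZero⁻¹ k {{nonZeroIndex (p v)}})
        (All.map⁺ (All.tabulate (leafCount<order ∘ ∈-strongSupports⁻)))

mainTheorem6 : ∀ {n} (T : Graph n) → IsTree T → (∃ λ v → StrongSupport T v) →
    HasPCPartition T → PCAtLeast T (suc (maxStrongLeaves T))
mainTheorem6 T _ (v , _) (k , p , partition@(_ , _ , coalitions)) =
  k , maxStrongLeaves<order T p coalition v , p , partition
  where
  coalition : ∀ i → ∃ λ j → PairedDominating T (classOf p i ∪ classOf p j)
  coalition i = let (j , _ , dominating) = coalitions i in j , dominating
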